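{- Let $d>1$ be a constant and let $\mathcal{A}_d$ be any algorithm solving the $(n,d)$-array problem, without recomputation, on a BSP with $p$ processors, where $1<p\le n^{d-1}$, and let $W$ be the maximum number of nodes evaluated by a processor. If $W\le\epsilon n^d$ for an arbitrary constant $\epsilon\in(0,1)$, then the communication complexity of $\mathcal{A}_d$ is $H_{\mathcal{A}_d}(n,p)=\Omega(W^{(d-1)/d})$.
   Context: BSP model: $p$ processors, each with an unbounded private local memory, connected by a communication network; computation proceeds in supersteps, each consisting of local computation and message sending (one data word per message) followed by a global synchronization. If $h_i$ is the maximum number of messages sent or received by any processor in superstep $i$, the communication complexity is $H=\sum_i h_i$. The $d$-dimensional array DAG of size $n$ has $n^d$ nodes $\langle i_0,\dots,i_{d-1}\rangle$, $0\le i_0,\dots,i_{d-1}<n$, and an arc from $\langle i_0,\dots,i_k,\dots,i_{d-1}\rangle$ to $\langle i_0,\dots,i_k+1,\dots,i_{d-1}\rangle$ whenever $i_k+1<n$, for each $0\le k<d$. The $(n,d)$-array problem is to evaluate all nodes of this DAG, where a node can be evaluated by a processor only when the values of all its predecessors are available to that processor. "Without recomputation" means each node is evaluated exactly once, by exactly one processor. Constants in $\Omega$ may depend on $d$ and $\epsilon$. -}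

module Defs where

open import Data.Nat using (ℕ; zero; suc; _+_; _*_; _∸_; _^_; _≤_; _<_; _⊔_)
open import Data.Fin using (Fin; toℕ)
open import Data.Fin.Properties using (_≟_)
open import Data.Vec using (Vec; []; _∷_; lookup)
open import Data.List using (List; []; _∷_; map; concatMap; filter; length; foldr; allFin; upTo)
open import Data.Nat.ListAction using (sum)
open import Data.List.Membership.Propositional using (_∈_)
open import Data.Product using (Σ; ∃; _×_; _,_; proj₁; proj₂)
open import Data.Sum using (_⊎_)
open import Relation.Binary.PropositionalEquality using (_≡_; _≢_)

Node : ℕ → ℕ → Set
Node n d = Vec (Fin n) d

Arc : ∀ {n d} → Node n d → Node n d → Set
Arc {n} {d} u v =
  Σ (Fin d) λ k → (toℕ (lookup v k) ≡ suc (toℕ (lookup u k)))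
                  × (∀ j → j ≢ k → lookup u j ≡ lookup v j)

allNodes : (n d : ℕ) → List (Node n d)
allNodes n zero = [] ∷ []
allNodes n (suc d) = concatMap (λ i → map (i ∷_) (allNodes n d)) (allFin n)

-- Maximum of a function over the processors Fin p (0 if p = 0).
maxOver : (p : ℕ) → (Fin p → ℕ) → ℕ
maxOver p f = foldr _⊔_ 0 (map f (allFin p))

-- A message: (sender, receiver, node whose value – one data word – is sent).
Msg : ℕ → ℕ → ℕ → Set
Msg n d p = Fin p × Fin p × Node n d

sender receiver : ∀ {n d p} → Msg n d p → Fin p
sender (a , _ , _) = a
receiver (_ , b , _) = b

-- A BSP algorithm for the (n,d)-array problem on p processors, WITHOUT
-- recomputation: every node is evaluated exactly once, by processor
-- 'proc u', in superstep 'step u'.  'msgs s' is the list of messages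
-- sent in superstep s (delivered at the synchronisation ending s).
record BSPAlg (n d p : ℕ) : Set where
  field
    S     : ℕ
    proc  : Node n d → Fin p
    step  : Node n d → ℕ
    step< : ∀ u → step u < S
    msgs  : ℕ → List (Msg n d p)

  Has : Fin p → Node n d → ℕ → Set
  Has q u s = (proc u ≡ q × step u ≤ s)
            ⊎ ∃ λ t → t < s × ∃ λ a → (a , q , u) ∈ msgs t

  sent recv : Fin p → ℕ → ℕ
  sent q s = length (filter (λ m → sender m ≟ q) (msgs s))
  recv q s = length (filter (λ m → receiver m ≟ q) (msgs s))

  h : ℕ → ℕ
  h s = maxOver p (λ q → sent q s ⊔ recv q s)

  H : ℕ
  H = sum (map h (upTo S))

  load : Fin p → ℕ
  load q = length (filter (λ u → proc u ≟ q) (allNodes n d))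

  W : ℕ
  W = maxOver p load

record Valid {n d p : ℕ} (A : BSPAlg n d p) : Set where
  open BSPAlg A
  field
    evalOK : ∀ u v → Arc u v → Has (proc v) u (step v)
    sendOK : ∀ s a b u → (a , b , u) ∈ msgs s → Has a u s
    noLate : ∀ s → S ≤ s → msgs s ≡ []

-- Let q be a processor attaining W and U ⊆ [n]^d the set of nodes it evaluates.
-- Call an axis-parallel line of the cube mixed if it meets both U and its
-- complement.  A mixed line contains an arc leaving or entering U, and the value
-- of its tail must then be sent or received by q; charging the line to these
-- words shows that every direction has at most 2H mixed lines.  A weak
-- Loomis–Whitney inequality bounds |U|^(d-1) by the d-th power of the total size
-- of the projections of U, and each projection consists of lines inside U (at
-- most |U|/n of them) and mixed lines.  So either the mixed lines dominate, and
-- |U|^(d-1) = O(H^d) directly, or |U| ≥ n^d / O(1); as W ≤ ε n^d the complement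
-- is then also a fixed fraction of the cube, and a discrete isoperimetric
-- inequality yields Ω(n^(d-1)) mixed lines, hence |U|^(d-1) ≤ n^(d(d-1)) = O(H^d).

module Submission where

open import Defs
open import Data.Nat using (ℕ; _*_; _∸_; _^_; _≤_; _<_)
open import Data.Product using (Σ; _×_)

import Algebra.Properties.Semiring.Sum
open import Data.Bool using (Bool; true; false; not; _∧_; _∨_)
open import Data.Bool.Properties using (∨-assoc; ∨-idem; ∨-zeroʳ; ∧-comm; not-involutive) renaming (_≟_ to _≟ᵇ_)
open import Data.Empty using (⊥-elim)
open import Data.Fin using (Fin; zero; suc; toℕ)
open import Data.Fin.Properties using (_≟_)
open import Data.List using (List; []; _∷_; _++_; map; concatMap; filter; length; tabulate; upTo; allFin)
  renaming (foldr to foldrᴸ)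
open import Data.List.Membership.Propositional using (_∈_)
open import Data.List.Membership.Propositional.Properties using (foldr-selective; ∈-map⁺; ∈-map⁻; ∈-allFin; ∈-upTo⁺)
open import Data.List.Relation.Unary.Any using (here; there)
open import Data.Nat using (zero; suc; _+_; _⊔_; z≤n; s≤s; _<?_; _≤?_; >-nonZero; >-nonZero⁻¹)
open import Data.Nat.Induction using (<-rec)
open import Data.Nat.ListAction using () renaming (sum to sumᴸ)
open import Data.Nat.Properties hiding (_≟_)
open import Data.Nat.Tactic.RingSolver using (solve-∀)
open import Data.Product using (∃; ∃₂; _,_)
open import Data.Sum using (_⊎_; inj₁; inj₂)
open import Data.Vec using ([]; _∷_)
open import Data.Vec.Functional using (foldr)
open import Data.Vec.Properties using (≡-dec)
open import Function using (_∘_; id)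
open import Relation.Binary.Definitions using (DecidableEquality)
open import Relation.Binary.PropositionalEquality
open import Relation.Nullary using (Dec; yes; no; does; contradiction)
open import Relation.Nullary.Decidable using (dec-true)
open import Relation.Unary using (Decidable)

open Algebra.Properties.Semiring.Sum +-*-semiring
  using (sum-syntax; ∑-distrib-+; ∑-comm; *-distribˡ-sum; sum-cong-≗)

𝟙 : Bool → ℕ
𝟙 true = 1
𝟙 false = 0

𝟙≤1 : ∀ b → 𝟙 b ≤ 1
𝟙≤1 true = ≤-refl
𝟙≤1 false = z≤n

sum-mono-≤ : ∀ {m} {f g : Fin m → ℕ} → (∀ i → f i ≤ g i) → ∑[ i < m ] f i ≤ ∑[ i < m ] g i
sum-mono-≤ {zero} f≤g = z≤n
sum-mono-≤ {suc m} f≤g = +-mono-≤ (f≤g zero) (sum-mono-≤ (f≤g ∘ suc))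

sum-const : ∀ m c → ∑[ i < m ] c ≡ m * c
sum-const zero c = refl
sum-const (suc m) c = cong (c +_) (sum-const m c)

sum-≤-const : ∀ {m c} {f : Fin m → ℕ} → (∀ i → f i ≤ c) → ∑[ i < m ] f i ≤ m * c
sum-≤-const {m} {c} f≤c = ≤-trans (sum-mono-≤ f≤c) (≤-reflexive (sum-const m c))

term≤sum : ∀ {m} (f : Fin m → ℕ) i → f i ≤ ∑[ j < m ] f j
term≤sum f zero = m≤m+n _ _
term≤sum f (suc i) = ≤-trans (term≤sum (f ∘ suc) i) (m≤n+m _ _)

^-distribʳ-* : ∀ m n o → (m * n) ^ o ≡ m ^ o * n ^ o
^-distribʳ-* m n zero = refl
^-distribʳ-* m n (suc o) = begin
  m * n * (m * n) ^ o     ≡⟨ cong (m * n *_) (^-distribʳ-* m n o) ⟩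
  m * n * (m ^ o * n ^ o) ≡⟨ regroup m n (m ^ o) (n ^ o) ⟩
  m * m ^ o * (n * n ^ o) ∎
  where
  open ≡-Reasoning
  regroup : ∀ a b c e → a * b * (c * e) ≡ a * c * (b * e)
  regroup = solve-∀

-- The mediant (x + X) / (y + Y) lies between x / y and X / Y, so it inherits
-- any bound satisfied by both ratios.
mediant-^-bound : ∀ e K x X y Y → x * Y ≤ X * y → x ^ e ≤ K * y ^ e → X ^ e ≤ K * Y ^ e →
  (x + X) ^ e ≤ K * (y + Y) ^ e
mediant-^-bound zero K x X y Y _ _ X≤ = X≤
mediant-^-bound e@(suc _) K x X y zero _ x≤ X≤
  with refl ← m^n≡0⇒m≡0 X e (n≤0⇒n≡0 (≤-trans X≤ (≤-reflexive (*-zeroʳ K))))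
  rewrite +-identityʳ x | +-identityʳ y = x≤
mediant-^-bound e K x X y Y@(suc _) xY≤Xy _ X≤ = *-cancelʳ-≤ _ _ (Y ^ e) {{m^n≢0 Y e}} (begin
  (x + X) ^ e * Y ^ e   ≡⟨ ^-distribʳ-* (x + X) Y e ⟨
  ((x + X) * Y) ^ e     ≤⟨ ^-monoˡ-≤ e mediant≤ ⟩
  (X * (y + Y)) ^ e     ≡⟨ ^-distribʳ-* X (y + Y) e ⟩
  X ^ e * (y + Y) ^ e   ≤⟨ *-monoˡ-≤ ((y + Y) ^ e) X≤ ⟩
  K * Y ^ e * (y + Y) ^ e ≡⟨ swap K (Y ^ e) ((y + Y) ^ e) ⟩
  K * (y + Y) ^ e * Y ^ e ∎)
  where
  open ≤-Reasoning
  mediant≤ : (x + X) * Y ≤ X * (y + Y)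
  mediant≤ = begin
    (x + X) * Y   ≡⟨ *-distribʳ-+ Y x X ⟩
    x * Y + X * Y ≤⟨ +-monoˡ-≤ (X * Y) xY≤Xy ⟩
    X * y + X * Y ≡⟨ *-distribˡ-+ X y Y ⟨
    X * (y + Y)   ∎
  swap : ∀ a b c → a * b * c ≡ a * c * b
  swap = solve-∀

+-preserves-^-bound : ∀ e K x X y Y → x ^ e ≤ K * y ^ e → X ^ e ≤ K * Y ^ e →
  (x + X) ^ e ≤ K * (y + Y) ^ e
+-preserves-^-bound e K x X y Y x≤ X≤ with ≤-total (x * Y) (X * y)
... | inj₁ xY≤Xy = mediant-^-bound e K x X y Y xY≤Xy x≤ X≤
... | inj₂ Xy≤xY = subst₂ (λ s t → s ^ e ≤ K * t ^ e) (+-comm X x) (+-comm Y y)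
  (mediant-^-bound e K X x Y y Xy≤xY X≤ x≤)

sum-preserves-^-bound : ∀ {m} e K (x y : Fin m → ℕ) → (∀ i → x i ^ suc e ≤ K * y i ^ suc e) →
  (∑[ i < m ] x i) ^ suc e ≤ K * (∑[ i < m ] y i) ^ suc e
sum-preserves-^-bound {zero} e K x y _ = z≤n
sum-preserves-^-bound {suc m} e K x y bound = +-preserves-^-bound (suc e) K (x zero) _ (y zero) _
  (bound zero) (sum-preserves-^-bound e K (x ∘ suc) (y ∘ suc) (bound ∘ suc))

m≤n+o∧2o<m⇒m≤2n : ∀ {m n o} → m ≤ n + o → 2 * o < m → m ≤ 2 * n
m≤n+o∧2o<m⇒m≤2n {m} {n} {o} m≤n+o 2o<m = <⇒≤ (+-cancelʳ-< m m (2 * n) (begin-strict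
  m + m               ≤⟨ +-mono-≤ m≤n+o m≤n+o ⟩
  (n + o) + (n + o)   ≡⟨ regroup n o ⟩
  2 * n + 2 * o       <⟨ +-monoʳ-< (2 * n) 2o<m ⟩
  2 * n + m           ∎))
  where
  open ≤-Reasoning
  regroup : ∀ n o → (n + o) + (n + o) ≡ 2 * n + 2 * o
  regroup = solve-∀

-- Lines: Boolean functions on Fin m

meets full mixed : ∀ {m} → (Fin m → Bool) → Bool
meets = foldr _∨_ false
full g = not (meets (not ∘ g))
mixed g = meets g ∧ meets (not ∘ g)

card : ∀ {m} → (Fin m → Bool) → ℕ
card {m} g = ∑[ t < m ] 𝟙 (g t)

card≤ : ∀ {m} (g : Fin m → Bool) → card g ≤ m
card≤ {m} g = ≤-trans (sum-≤-const (𝟙≤1 ∘ g)) (≤-reflexive (*-identityʳ m))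

meets-cong : ∀ {m} {g h : Fin m → Bool} → (∀ t → g t ≡ h t) → meets g ≡ meets h
meets-cong {zero} g≗h = refl
meets-cong {suc m} g≗h = cong₂ _∨_ (g≗h zero) (meets-cong (g≗h ∘ suc))

¬meets⇒false : ∀ {m} (g : Fin m → Bool) → meets g ≡ false → ∀ t → g t ≡ false
¬meets⇒false g ¬meets zero with g zero
... | false = refl
¬meets⇒false g ¬meets (suc t) with g zero
... | false = ¬meets⇒false (g ∘ suc) ¬meets t

full⇒true : ∀ {m} (g : Fin m → Bool) → full g ≡ true → ∀ t → g t ≡ true
full⇒true g full-g t = trans (sym (not-involutive (g t))) (cong not (¬meets⇒false (not ∘ g) ¬meets t))
  where
  ¬meets : meets (not ∘ g) ≡ false
  ¬meets = trans (sym (not-involutive _)) (cong not full-g)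

𝟙≤𝟙-meets : ∀ {m} (g : Fin m → Bool) t → 𝟙 (g t) ≤ 𝟙 (meets g)
𝟙≤𝟙-meets g t with meets g in eq
... | true = 𝟙≤1 (g t)
... | false = ≤-reflexive (cong 𝟙 (¬meets⇒false g eq t))

card-¬meets : ∀ {m} (g : Fin m → Bool) → meets g ≡ false → card g ≡ 0
card-¬meets {m} g ¬meets = begin
  card g          ≡⟨ sum-cong-≗ (cong 𝟙 ∘ ¬meets⇒false g ¬meets) ⟩
  ∑[ t < m ] 0    ≡⟨ sum-const m 0 ⟩
  m * 0           ≡⟨ *-zeroʳ m ⟩
  0               ∎
  where open ≡-Reasoning

m*full≤card : ∀ {m} (g : Fin m → Bool) → m * 𝟙 (full g) ≤ card g
m*full≤card {m} g with full g in full-g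
... | false = ≤-trans (≤-reflexive (*-zeroʳ m)) z≤n
... | true = ≤-reflexive (begin
  m * 1           ≡⟨ sum-const m 1 ⟨
  ∑[ t < m ] 1    ≡⟨ sum-cong-≗ (cong 𝟙 ∘ full⇒true g full-g) ⟨
  card g          ∎)
  where open ≡-Reasoning

𝟙-full≤ : ∀ {m} (g : Fin m → Bool) t → 𝟙 (full g) ≤ 𝟙 (g t)
𝟙-full≤ g t with full g in full-g
... | false = z≤n
... | true = ≤-reflexive (cong 𝟙 (sym (full⇒true g full-g t)))

meets≤full+mixed : ∀ {m} (g : Fin m → Bool) → 𝟙 (meets g) ≤ 𝟙 (full g) + 𝟙 (mixed g)
meets≤full+mixed g with meets g | meets (not ∘ g)
... | true | true = ≤-refl
... | true | false = ≤-refl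
... | false | _ = z≤n

card≤m*[full+mixed] : ∀ {m} (g : Fin m → Bool) → card g ≤ m * (𝟙 (full g) + 𝟙 (mixed g))
card≤m*[full+mixed] {m} g with meets g in meets-g | meets (not ∘ g)
... | false | _ = ≤-trans (≤-reflexive (card-¬meets g meets-g)) z≤n
... | true | true = ≤-trans (card≤ g) (≤-reflexive (sym (*-identityʳ m)))
... | true | false = ≤-trans (card≤ g) (≤-reflexive (sym (*-identityʳ m)))

mixed-not : ∀ {m} (g : Fin m → Bool) → mixed (not ∘ g) ≡ mixed g
mixed-not g = trans (cong (meets (not ∘ g) ∧_) (meets-cong (not-involutive ∘ g))) (∧-comm (meets (not ∘ g)) (meets g))

card-singleton : ∀ {m} (i : Fin m) → card (λ t → does (i ≟ t)) ≡ 1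
card-singleton {suc m} zero = cong suc (trans (sum-const m 0) (*-zeroʳ m))
card-singleton {suc m} (suc i) = card-singleton i

meets-dup : ∀ {m} (g : Fin (suc (suc m)) → Bool) → g zero ≡ g (suc zero) → meets g ≡ meets (g ∘ suc)
meets-dup g g₀≡g₁ = begin
  g₀ ∨ (g₁ ∨ r)   ≡⟨ cong (_∨ (g₁ ∨ r)) g₀≡g₁ ⟩
  g₁ ∨ (g₁ ∨ r)   ≡⟨ ∨-assoc g₁ g₁ r ⟨
  (g₁ ∨ g₁) ∨ r   ≡⟨ cong (_∨ r) (∨-idem g₁) ⟩
  g₁ ∨ r          ∎
  where
  open ≡-Reasoning
  g₀ g₁ r : Bool
  g₀ = g zero
  g₁ = g (suc zero)
  r = meets (λ t → g (suc (suc t)))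

mixed-dup : ∀ {m} (g : Fin (suc (suc m)) → Bool) → g zero ≡ g (suc zero) → mixed g ≡ mixed (g ∘ suc)
mixed-dup g g₀≡g₁ = cong₂ _∧_ (meets-dup g g₀≡g₁) (meets-dup (not ∘ g) (cong not g₀≡g₁))

Switch : ∀ {m} → (Fin m → Bool) → Set
Switch g = ∃₂ λ t t′ → toℕ t′ ≡ suc (toℕ t) × g t ≢ g t′

switch-here-or-later : ∀ {m} (g : Fin (suc (suc m)) → Bool) → (g zero ≡ g (suc zero) → Switch (g ∘ suc)) → Switch g
switch-here-or-later g later with g zero ≟ᵇ g (suc zero)
... | no g₀≢g₁ = zero , suc zero , refl , g₀≢g₁
... | yes g₀≡g₁ with t , t′ , adjacent , g≢ ← later g₀≡g₁ = suc t , suc t′ , cong suc adjacent , g≢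

mixed⇒switch : ∀ {m} (g : Fin m → Bool) → mixed g ≡ true → Switch g
mixed⇒switch {suc zero} g mixed-g with g zero | mixed-g
... | true | ()
... | false | ()
mixed⇒switch {suc (suc m)} g mixed-g = switch-here-or-later g λ g₀≡g₁ →
  mixed⇒switch (g ∘ suc) (trans (sym (mixed-dup g g₀≡g₁)) mixed-g)

0<card⇒meets : ∀ {m} (g : Fin m → Bool) → 0 < card g → meets g ≡ true
0<card⇒meets g 0<card with meets g in meets-g
... | true = refl
... | false = ⊥-elim (<⇒≢ 0<card (sym (card-¬meets g meets-g)))

count : ∀ {A : Set} → (A → Bool) → List A → ℕ
count P [] = 0
count P (x ∷ xs) = 𝟙 (P x) + count P xs

module _ {A : Set} where

  length-filter≡count : ∀ {P : A → Set} (P? : Decidable P) xs → length (filter P? xs) ≡ count (does ∘ P?) xs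
  length-filter≡count P? [] = refl
  length-filter≡count P? (x ∷ xs) with does (P? x)
  ... | true = cong suc (length-filter≡count P? xs)
  ... | false = length-filter≡count P? xs

  count-++ : ∀ P (xs ys : List A) → count P (xs ++ ys) ≡ count P xs + count P ys
  count-++ P [] ys = refl
  count-++ P (x ∷ xs) ys = trans (cong (𝟙 (P x) +_) (count-++ P xs ys)) (sym (+-assoc (𝟙 (P x)) _ _))

  count-map : ∀ {B : Set} P (f : B → A) xs → count P (map f xs) ≡ count (P ∘ f) xs
  count-map P f [] = refl
  count-map P f (x ∷ xs) = cong (𝟙 (P (f x)) +_) (count-map P f xs)

  count-concatMap-tabulate : ∀ {B : Set} {m} P (f : B → List A) (g : Fin m → B) →
    count P (concatMap f (tabulate g)) ≡ ∑[ i < m ] count P (f (g i))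
  count-concatMap-tabulate {m = zero} P f g = refl
  count-concatMap-tabulate {m = suc m} P f g = trans (count-++ P (f (g zero)) _)
    (cong (count P (f (g zero)) +_) (count-concatMap-tabulate P f (g ∘ suc)))

  count-∨ : ∀ P Q (xs : List A) → count (λ x → P x ∨ Q x) xs ≤ count P xs + count Q xs
  count-∨ P Q [] = z≤n
  count-∨ P Q (x ∷ xs) = ≤-trans (+-mono-≤ (𝟙-∨ (P x) (Q x)) (count-∨ P Q xs))
    (≤-reflexive (regroup (𝟙 (P x)) (𝟙 (Q x)) (count P xs) (count Q xs)))
    where
    𝟙-∨ : ∀ a b → 𝟙 (a ∨ b) ≤ 𝟙 a + 𝟙 b
    𝟙-∨ true b = s≤s z≤n
    𝟙-∨ false b = ≤-refl
    regroup : ∀ a b c e → (a + b) + (c + e) ≡ (a + c) + (b + e)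
    regroup = solve-∀

  ∈⇒1≤count : ∀ P {x} {xs : List A} → x ∈ xs → P x ≡ true → 1 ≤ count P xs
  ∈⇒1≤count P (here refl) Px rewrite Px = s≤s z≤n
  ∈⇒1≤count P (there x∈) Px = ≤-trans (∈⇒1≤count P x∈ Px) (m≤n+m _ _)

  ∈⇒≤sumᴸ : ∀ (f : A → ℕ) {x xs} → x ∈ xs → f x ≤ sumᴸ (map f xs)
  ∈⇒≤sumᴸ f (here refl) = m≤m+n _ _
  ∈⇒≤sumᴸ f (there x∈) = ≤-trans (∈⇒≤sumᴸ f x∈) (m≤n+m _ _)

∈⇒≤max : ∀ {x xs} → x ∈ xs → x ≤ foldrᴸ _⊔_ 0 xs
∈⇒≤max (here refl) = m≤m⊔n _ _
∈⇒≤max (there x∈) = ≤-trans (∈⇒≤max x∈) (m≤n⊔m _ _)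

maxOver-≥ : ∀ p (f : Fin p → ℕ) q → f q ≤ maxOver p f
maxOver-≥ p f q = ∈⇒≤max (∈-map⁺ f (∈-allFin q))

maxOver-attained : ∀ p (f : Fin p → ℕ) → maxOver p f ≡ 0 ⊎ ∃ λ q → maxOver p f ≡ f q
maxOver-attained p f with foldr-selective ⊔-sel 0 (map f (allFin p))
... | inj₁ max≡0 = inj₁ max≡0
... | inj₂ max∈ with q , _ , max≡ ← ∈-map⁻ f max∈ = inj₂ (q , max≡)

-- The cube [n]^d and its axis-parallel lines

module _ {n : ℕ} where

  cubeSum : ∀ d → (Node n d → ℕ) → ℕ
  cubeSum zero f = f []
  cubeSum (suc d) f = ∑[ i < n ] cubeSum d (f ∘ (i ∷_))

  cubeSum-cong : ∀ d {f g : Node n d → ℕ} → (∀ u → f u ≡ g u) → cubeSum d f ≡ cubeSum d g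
  cubeSum-cong zero f≗g = f≗g []
  cubeSum-cong (suc d) f≗g = sum-cong-≗ λ i → cubeSum-cong d (f≗g ∘ (i ∷_))

  cubeSum-mono-≤ : ∀ d {f g : Node n d → ℕ} → (∀ u → f u ≤ g u) → cubeSum d f ≤ cubeSum d g
  cubeSum-mono-≤ zero f≤g = f≤g []
  cubeSum-mono-≤ (suc d) f≤g = sum-mono-≤ λ i → cubeSum-mono-≤ d (f≤g ∘ (i ∷_))

  cubeSum-distrib-+ : ∀ d (f g : Node n d → ℕ) → cubeSum d (λ u → f u + g u) ≡ cubeSum d f + cubeSum d g
  cubeSum-distrib-+ zero f g = refl
  cubeSum-distrib-+ (suc d) f g = trans (sum-cong-≗ λ i → cubeSum-distrib-+ d (f ∘ (i ∷_)) (g ∘ (i ∷_)))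
    (∑-distrib-+ (λ i → cubeSum d (f ∘ (i ∷_))) (λ i → cubeSum d (g ∘ (i ∷_))))

  cubeSum-distribˡ-* : ∀ d c (f : Node n d → ℕ) → cubeSum d (λ u → c * f u) ≡ c * cubeSum d f
  cubeSum-distribˡ-* zero c f = refl
  cubeSum-distribˡ-* (suc d) c f = trans (sum-cong-≗ λ i → cubeSum-distribˡ-* d c (f ∘ (i ∷_)))
    (sym (*-distribˡ-sum c (λ i → cubeSum d (f ∘ (i ∷_)))))

  cubeSum-const : ∀ d c → cubeSum d (λ _ → c) ≡ n ^ d * c
  cubeSum-const zero c = sym (*-identityˡ c)
  cubeSum-const (suc d) c = begin
    ∑[ i < n ] cubeSum d (λ _ → c)   ≡⟨ sum-cong-≗ {n} (λ _ → cubeSum-const d c) ⟩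
    ∑[ i < n ] (n ^ d * c)           ≡⟨ sum-const n (n ^ d * c) ⟩
    n * (n ^ d * c)                  ≡⟨ *-assoc n (n ^ d) c ⟨
    n * n ^ d * c                    ∎
    where open ≡-Reasoning

  cubeSum-zero : ∀ d → cubeSum d (λ _ → 0) ≡ 0
  cubeSum-zero d = trans (cubeSum-const d 0) (*-zeroʳ (n ^ d))

  ∑-cubeSum-comm : ∀ {m} d (f : Fin m → Node n d → ℕ) →
    ∑[ i < m ] cubeSum d (f i) ≡ cubeSum d (λ u → ∑[ i < m ] f i u)
  ∑-cubeSum-comm zero f = refl
  ∑-cubeSum-comm (suc d) f = trans (∑-comm (λ i t → cubeSum d (f i ∘ (t ∷_))))
    (sum-cong-≗ λ t → ∑-cubeSum-comm d (λ i → f i ∘ (t ∷_)))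

  volume : ∀ d → (Node n d → Bool) → ℕ
  volume d U = cubeSum d (𝟙 ∘ U)

  volume+volume-not : ∀ d (U : Node n d → Bool) → volume d U + volume d (not ∘ U) ≡ n ^ d
  volume+volume-not d U = begin
    volume d U + volume d (not ∘ U)            ≡⟨ cubeSum-distrib-+ d (𝟙 ∘ U) (𝟙 ∘ not ∘ U) ⟨
    cubeSum d (λ u → 𝟙 (U u) + 𝟙 (not (U u)))  ≡⟨ cubeSum-cong d (𝟙+𝟙-not ∘ U) ⟩
    cubeSum d (λ _ → 1)                        ≡⟨ cubeSum-const d 1 ⟩
    n ^ d * 1                                  ≡⟨ *-identityʳ (n ^ d) ⟩
    n ^ d                                      ∎
    where
    open ≡-Reasoning
    𝟙+𝟙-not : ∀ b → 𝟙 b + 𝟙 (not b) ≡ 1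
    𝟙+𝟙-not true = refl
    𝟙+𝟙-not false = refl

  volume≤ : ∀ d (U : Node n d → Bool) → volume d U ≤ n ^ d
  volume≤ d U = ≤-trans (m≤m+n _ _) (≤-reflexive (volume+volume-not d U))

  complement-large : ∀ d U {a b} → a < b → b * volume d U ≤ a * n ^ d → n ^ d ≤ b * volume d (not ∘ U)
  complement-large d U {a} {b} a<b bW≤an^d = +-cancelʳ-≤ (a * n ^ d) (n ^ d) (b * Wᶜ) (begin
    n ^ d + a * n ^ d     ≤⟨ *-monoˡ-≤ (n ^ d) a<b ⟩
    b * n ^ d             ≡⟨ cong (b *_) (volume+volume-not d U) ⟨
    b * (W + Wᶜ)          ≡⟨ *-distribˡ-+ b W Wᶜ ⟩
    b * W + b * Wᶜ        ≤⟨ +-monoˡ-≤ (b * Wᶜ) bW≤an^d ⟩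
    a * n ^ d + b * Wᶜ    ≡⟨ +-comm (a * n ^ d) (b * Wᶜ) ⟩
    b * Wᶜ + a * n ^ d    ∎)
    where
    open ≤-Reasoning
    W = volume d U
    Wᶜ = volume d (not ∘ U)

  -- lineSum d k φ U sums φ over the lines of [n]^d parallel to axis k, each line
  -- given by the restriction of U to it.
  lineSum : ∀ d → Fin d → ((Fin n → Bool) → ℕ) → (Node n d → Bool) → ℕ
  lineSum (suc d) zero φ U = cubeSum d (λ y → φ (λ t → U (t ∷ y)))
  lineSum (suc d) (suc k) φ U = ∑[ t < n ] lineSum d k φ (U ∘ (t ∷_))

  lineCount : ∀ d → Fin d → ((Fin n → Bool) → Bool) → (Node n d → Bool) → ℕ
  lineCount d k P = lineSum d k (𝟙 ∘ P)

  lineTotal : ∀ d → ((Fin n → Bool) → Bool) → (Node n d → Bool) → ℕ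
  lineTotal d P U = ∑[ k < d ] lineCount d k P U

  lineSum-mono-≤ : ∀ d k {φ ψ} → (∀ g → φ g ≤ ψ g) → ∀ U → lineSum d k φ U ≤ lineSum d k ψ U
  lineSum-mono-≤ (suc d) zero φ≤ψ U = cubeSum-mono-≤ d λ y → φ≤ψ (λ t → U (t ∷ y))
  lineSum-mono-≤ (suc d) (suc k) φ≤ψ U = sum-mono-≤ λ t → lineSum-mono-≤ d k φ≤ψ (U ∘ (t ∷_))

  lineSum-distrib-+ : ∀ d k φ ψ U → lineSum d k (λ g → φ g + ψ g) U ≡ lineSum d k φ U + lineSum d k ψ U
  lineSum-distrib-+ (suc d) zero φ ψ U = cubeSum-distrib-+ d _ _
  lineSum-distrib-+ (suc d) (suc k) φ ψ U =
    trans (sum-cong-≗ λ t → lineSum-distrib-+ d k φ ψ (U ∘ (t ∷_)))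
          (∑-distrib-+ (λ t → lineSum d k φ (U ∘ (t ∷_))) (λ t → lineSum d k ψ (U ∘ (t ∷_))))

  lineSum-distribˡ-* : ∀ d k c φ U → lineSum d k (λ g → c * φ g) U ≡ c * lineSum d k φ U
  lineSum-distribˡ-* (suc d) zero c φ U = cubeSum-distribˡ-* d c _
  lineSum-distribˡ-* (suc d) (suc k) c φ U =
    trans (sum-cong-≗ λ t → lineSum-distribˡ-* d k c φ (U ∘ (t ∷_)))
          (sym (*-distribˡ-sum c (λ t → lineSum d k φ (U ∘ (t ∷_)))))

  lineSum-card : ∀ d k U → lineSum d k card U ≡ volume d U
  lineSum-card (suc d) zero U = sym (∑-cubeSum-comm d λ t y → 𝟙 (U (t ∷ y)))
  lineSum-card (suc d) (suc k) U = sum-cong-≗ λ t → lineSum-card d k (U ∘ (t ∷_))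

  lineCount-mixed-not : ∀ d k U → lineCount d k mixed (not ∘ U) ≡ lineCount d k mixed U
  lineCount-mixed-not (suc d) zero U = cubeSum-cong d λ y → cong 𝟙 (mixed-not (λ t → U (t ∷ y)))
  lineCount-mixed-not (suc d) (suc k) U = sum-cong-≗ λ t → lineCount-mixed-not d k (U ∘ (t ∷_))

  lineTotal-slices : ∀ d P U → ∑[ t < n ] lineTotal d P (U ∘ (t ∷_)) ≡ ∑[ k < d ] lineCount (suc d) (suc k) P U
  lineTotal-slices d P U = ∑-comm λ t k → lineCount d k P (U ∘ (t ∷_))

  lineTotal-meets≤full+mixed : ∀ d U → lineTotal d meets U ≤ lineTotal d full U + lineTotal d mixed U
  lineTotal-meets≤full+mixed d U = begin
    ∑[ k < d ] lineCount d k meets U                           ≤⟨ sum-mono-≤ meets≤ ⟩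
    ∑[ k < d ] (lineCount d k full U + lineCount d k mixed U)  ≡⟨ ∑-distrib-+ (λ k → lineCount d k full U) _ ⟩
    lineTotal d full U + lineTotal d mixed U                   ∎
    where
    open ≤-Reasoning
    meets≤ : ∀ k → lineCount d k meets U ≤ lineCount d k full U + lineCount d k mixed U
    meets≤ k = ≤-trans (lineSum-mono-≤ d k meets≤full+mixed U)
                       (≤-reflexive (lineSum-distrib-+ d k (𝟙 ∘ full) (𝟙 ∘ mixed) U))

  n*full≤volume : ∀ d k U → n * lineCount d k full U ≤ volume d U
  n*full≤volume d k U = begin
    n * lineCount d k full U                  ≡⟨ lineSum-distribˡ-* d k n (𝟙 ∘ full) U ⟨
    lineSum d k (λ g → n * 𝟙 (full g)) U      ≤⟨ lineSum-mono-≤ d k m*full≤card U ⟩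
    lineSum d k card U                        ≡⟨ lineSum-card d k U ⟩
    volume d U                                ∎
    where open ≤-Reasoning

  volume≤n*[full+mixed] : ∀ d k U → volume d U ≤ n * (lineCount d k full U + lineCount d k mixed U)
  volume≤n*[full+mixed] d k U = begin
    volume d U                                             ≡⟨ lineSum-card d k U ⟨
    lineSum d k card U                                     ≤⟨ lineSum-mono-≤ d k card≤m*[full+mixed] U ⟩
    lineSum d k (λ g → n * (𝟙 (full g) + 𝟙 (mixed g))) U   ≡⟨ lineSum-distribˡ-* d k n _ U ⟩
    n * lineSum d k (λ g → 𝟙 (full g) + 𝟙 (mixed g)) U     ≡⟨ cong (n *_) (lineSum-distrib-+ d k (𝟙 ∘ full) (𝟙 ∘ mixed) U) ⟩
    n * (lineCount d k full U + lineCount d k mixed U)     ∎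
    where open ≤-Reasoning

  full-lines≤slice : ∀ d U t → lineCount (suc d) zero full U ≤ volume d (U ∘ (t ∷_))
  full-lines≤slice d U t = cubeSum-mono-≤ d λ y → 𝟙-full≤ (λ t′ → U (t′ ∷ y)) t

  -- Weak Loomis–Whitney: |U|^(D-1) ≤ (Σₖ |πₖ U|)^D, multiplied by |U| so that it
  -- also holds for empty U; lineCount d k meets U is the size of the projection πₖ U.
  loomis-whitney : ∀ d U → volume (suc d) U ^ suc d ≤ volume (suc d) U * lineTotal (suc d) meets U ^ suc d
  loomis-whitney zero U with meets (λ t → U (t ∷ [])) in meets-line
  ... | true = ≤-refl
  ... | false = ≤-trans (≤-reflexive (cong (_* 1) (card-¬meets (λ t → U (t ∷ [])) meets-line))) z≤n
  loomis-whitney (suc d) U = begin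
    W * W ^ suc d                        ≤⟨ *-monoʳ-≤ W slices ⟩
    W * (P₀ * R ^ suc d)                 ≤⟨ *-monoʳ-≤ W (*-mono-≤ (m≤m+n P₀ R) (^-monoˡ-≤ (suc d) (m≤n+m R P₀))) ⟩
    W * ((P₀ + R) * (P₀ + R) ^ suc d)    ∎
    where
    open ≤-Reasoning
    W = volume (suc (suc d)) U
    P₀ = lineCount (suc (suc d)) zero meets U
    R = ∑[ k < suc d ] lineCount (suc (suc d)) (suc k) meets U
    x y : Fin n → ℕ
    x t = volume (suc d) (U ∘ (t ∷_))
    y t = lineTotal (suc d) meets (U ∘ (t ∷_))
    x≤P₀ : ∀ t → x t ≤ P₀
    x≤P₀ t = cubeSum-mono-≤ (suc d) λ z → 𝟙≤𝟙-meets (λ t′ → U (t′ ∷ z)) t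
    slices : W ^ suc d ≤ P₀ * R ^ suc d
    slices = subst (λ r → W ^ suc d ≤ P₀ * r ^ suc d) (lineTotal-slices (suc d) meets U)
      (sum-preserves-^-bound d P₀ x y λ t → ≤-trans (loomis-whitney d (U ∘ (t ∷_))) (*-monoˡ-≤ _ (x≤P₀ t)))

  n*full≤d*volume : ∀ d U → n * lineTotal d full U ≤ d * volume d U
  n*full≤d*volume d U = begin
    n * ∑[ k < d ] lineCount d k full U      ≡⟨ *-distribˡ-sum n (λ k → lineCount d k full U) ⟩
    ∑[ k < d ] (n * lineCount d k full U)    ≤⟨ sum-≤-const (λ k → n*full≤volume d k U) ⟩
    d * volume d U                           ∎
    where open ≤-Reasoning

  loomis-whitney-mixed : ∀ d U → 0 < volume (suc d) U →
    n ^ suc d * volume (suc d) U ^ d ≤ (suc d * volume (suc d) U + n * lineTotal (suc d) mixed U) ^ suc d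
  loomis-whitney-mixed d U 0<W = begin
    n ^ D * W ^ d                  ≤⟨ *-monoʳ-≤ (n ^ D) W^d≤Q^D ⟩
    n ^ D * Q ^ D                  ≡⟨ ^-distribʳ-* n Q D ⟨
    (n * Q) ^ D                    ≤⟨ ^-monoˡ-≤ D (*-monoʳ-≤ n (lineTotal-meets≤full+mixed D U)) ⟩
    (n * (F + M)) ^ D              ≡⟨ cong (_^ D) (*-distribˡ-+ n F M) ⟩
    (n * F + n * M) ^ D            ≤⟨ ^-monoˡ-≤ D (+-monoˡ-≤ (n * M) (n*full≤d*volume D U)) ⟩
    (D * W + n * M) ^ D            ∎
    where
    open ≤-Reasoning
    D = suc d
    W = volume D U
    Q = lineTotal D meets U
    F = lineTotal D full U
    M = lineTotal D mixed U
    W^d≤Q^D : W ^ d ≤ Q ^ D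
    W^d≤Q^D = *-cancelˡ-≤ W {{>-nonZero 0<W}} (loomis-whitney d U)

-- Isoperimetry

isoConstant : ℕ → ℕ → ℕ
isoConstant K zero = 1
isoConstant K (suc d) = 2 * K + isoConstant (2 * K) d

module _ {n : ℕ} where

  large⇒nonempty : ∀ d K (U : Node n d → Bool) → 0 < n → n ^ d ≤ K * volume d U → 0 < volume d U
  large⇒nonempty d K U 0<n large =
    >-nonZero⁻¹ _ {{m*n≢0⇒n≢0 K {{>-nonZero (<-≤-trans (m^n>0 n {{>-nonZero 0<n}} d) large)}}}}

  large-slices : ∀ d K (U : Node n (suc d) → Bool) → 0 < n → n ^ suc d ≤ K * volume (suc d) U →
    2 * K * lineCount (suc d) zero mixed U < n ^ d → ∀ t → n ^ d ≤ 2 * K * volume d (U ∘ (t ∷_))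
  large-slices d K U 0<n large few-mixed t = begin
    n ^ d           ≤⟨ m≤n+o∧2o<m⇒m≤2n {n = K * F} {o = K * M} ≤KF+KM (subst (_< n ^ d) (*-assoc 2 K M) few-mixed) ⟩
    2 * (K * F)     ≡⟨ *-assoc 2 K F ⟨
    2 * K * F       ≤⟨ *-monoʳ-≤ (2 * K) (full-lines≤slice d U t) ⟩
    2 * K * volume d (U ∘ (t ∷_)) ∎
    where
    open ≤-Reasoning
    F = lineCount (suc d) zero full U
    M = lineCount (suc d) zero mixed U
    ≤KF+KM : n ^ d ≤ K * F + K * M
    ≤KF+KM = *-cancelˡ-≤ n {{>-nonZero 0<n}} (begin
      n * n ^ d                   ≤⟨ large ⟩
      K * volume (suc d) U        ≤⟨ *-monoʳ-≤ K (volume≤n*[full+mixed] (suc d) zero U) ⟩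
      K * (n * (F + M))           ≡⟨ x*[y*z]≡y*[x*z] K n (F + M) ⟩
      n * (K * (F + M))           ≡⟨ cong (n *_) (*-distribˡ-+ K F M) ⟩
      n * (K * F + K * M)         ∎)
      where
      x*[y*z]≡y*[x*z] : ∀ x y z → x * (y * z) ≡ y * (x * z)
      x*[y*z]≡y*[x*z] = solve-∀

  -- Either the mixed lines in direction 0 already suffice, or every slice
  -- orthogonal to direction 0 is again balanced (with 2K) and induction applies.
  isoperimetric : ∀ d K (U : Node n (suc d) → Bool) → 0 < n → n ^ suc d ≤ K * volume (suc d) U → n ^ suc d ≤ K * volume (suc d) (not ∘ U) →
    n ^ d ≤ isoConstant K d * lineTotal (suc d) mixed U
  isoperimetric zero K U 0<n U-large Uᶜ-large =
    subst (λ b → 1 ≤ 1 * (𝟙 b + 0)) (sym mixed-line) ≤-refl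
    where
    mixed-line : mixed (λ t → U (t ∷ [])) ≡ true
    mixed-line = cong₂ _∧_ (0<card⇒meets (λ t → U (t ∷ [])) (large⇒nonempty 1 K U 0<n U-large))
                           (0<card⇒meets (λ t → not (U (t ∷ []))) (large⇒nonempty 1 K (not ∘ U) 0<n Uᶜ-large))
  isoperimetric (suc d) K U 0<n U-large Uᶜ-large = by-cases (2 * K * M₀ <? n ^ suc d)
    where
    open ≤-Reasoning
    M₀ = lineCount (suc (suc d)) zero mixed U
    R = ∑[ k < suc d ] lineCount (suc (suc d)) (suc k) mixed U
    G = isoConstant (2 * K) d
    slice-bound : 2 * K * M₀ < n ^ suc d → ∀ t → n ^ d ≤ G * lineTotal (suc d) mixed (U ∘ (t ∷_))
    slice-bound few-mixed t = isoperimetric d (2 * K) (U ∘ (t ∷_)) 0<n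
      (large-slices (suc d) K U 0<n U-large few-mixed t)
      (large-slices (suc d) K (not ∘ U) 0<n Uᶜ-large
        (subst (λ m → 2 * K * m < n ^ suc d) (sym (lineCount-mixed-not (suc (suc d)) zero U)) few-mixed) t)
    by-cases : Dec (2 * K * M₀ < n ^ suc d) → n ^ suc d ≤ (2 * K + G) * (M₀ + R)
    by-cases (no many-mixed) = ≤-trans (≮⇒≥ many-mixed) (*-mono-≤ (m≤m+n (2 * K) G) (m≤m+n M₀ R))
    by-cases (yes few-mixed) = begin
      n * n ^ d                                         ≡⟨ sum-const n (n ^ d) ⟨
      ∑[ t < n ] (n ^ d)                                ≤⟨ sum-mono-≤ {n} (slice-bound few-mixed) ⟩
      ∑[ t < n ] (G * lineTotal (suc d) mixed (U ∘ (t ∷_)))  ≡⟨ *-distribˡ-sum G (λ t → lineTotal (suc d) mixed (U ∘ (t ∷_))) ⟨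
      G * ∑[ t < n ] lineTotal (suc d) mixed (U ∘ (t ∷_))    ≡⟨ cong (G *_) (lineTotal-slices (suc d) mixed U) ⟩
      G * R                                             ≤⟨ *-mono-≤ (m≤n+m G (2 * K)) (m≤n+m R M₀) ⟩
      (2 * K + G) * (M₀ + R)                            ∎

  module _ (d : ℕ) (U : Node n (2 + d) → Bool) (0<W : 0 < volume (2 + d) U) where
    private
      D W M : ℕ
      D = 2 + d
      W = volume D U
      M = lineTotal D mixed U

      0<n : 0 < n
      0<n = n≢0⇒n>0 λ n≡0 → <⇒≱ 0<W (subst (λ m → W ≤ m ^ D) n≡0 (volume≤ D U))

      key : n ^ D * W ^ suc d ≤ (D * W + n * M) ^ D
      key = loomis-whitney-mixed (suc d) U 0<W

      x*y+x*y≡x*[2*y] : ∀ x y → x * y + x * y ≡ x * (2 * y)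
      x*y+x*y≡x*[2*y] = solve-∀
      x*y+x*y≡2*x*y : ∀ x y → x * y + x * y ≡ 2 * x * y
      x*y+x*y≡2*x*y = solve-∀

    many-mixed⇒volume-bound : D * W ≤ n * M → W ^ suc d ≤ (2 * M) ^ D
    many-mixed⇒volume-bound DW≤nM = *-cancelˡ-≤ (n ^ D) {{m^n≢0 n D {{>-nonZero 0<n}}}} (begin
      n ^ D * W ^ suc d     ≤⟨ key ⟩
      (D * W + n * M) ^ D   ≤⟨ ^-monoˡ-≤ D (+-monoˡ-≤ (n * M) DW≤nM) ⟩
      (n * M + n * M) ^ D   ≡⟨ cong (_^ D) (x*y+x*y≡x*[2*y] n M) ⟩
      (n * (2 * M)) ^ D     ≡⟨ ^-distribʳ-* n (2 * M) D ⟩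
      n ^ D * (2 * M) ^ D   ∎)
      where open ≤-Reasoning

    few-mixed⇒volume-bound : ∀ K → n ^ D ≤ K * volume D (not ∘ U) → n * M < D * W →
      W ^ suc d ≤ (isoConstant ((2 * D) ^ D + K) (suc d) * M) ^ D
    few-mixed⇒volume-bound K Uᶜ-large nM<DW = begin
      W ^ suc d           ≤⟨ ^-monoˡ-≤ (suc d) (volume≤ D U) ⟩
      (n ^ D) ^ suc d     ≡⟨ ^-*-assoc n D (suc d) ⟩
      n ^ (D * suc d)     ≡⟨ cong (n ^_) (*-comm D (suc d)) ⟩
      n ^ (suc d * D)     ≡⟨ ^-*-assoc n (suc d) D ⟨
      (n ^ suc d) ^ D     ≤⟨ ^-monoˡ-≤ D (isoperimetric (suc d) K′ U 0<n U-large
                               (≤-trans Uᶜ-large (*-monoˡ-≤ (volume D (not ∘ U)) (m≤n+m K ((2 * D) ^ D))))) ⟩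
      (isoConstant K′ (suc d) * M) ^ D ∎
      where
      open ≤-Reasoning
      K′ = (2 * D) ^ D + K
      n^D≤[2D]^D*W : n ^ D ≤ (2 * D) ^ D * W
      n^D≤[2D]^D*W = *-cancelʳ-≤ (n ^ D) ((2 * D) ^ D * W) (W ^ suc d) {{m^n≢0 W (suc d) {{>-nonZero 0<W}}}} (begin
        n ^ D * W ^ suc d               ≤⟨ key ⟩
        (D * W + n * M) ^ D             ≤⟨ ^-monoˡ-≤ D (+-monoʳ-≤ (D * W) (<⇒≤ nM<DW)) ⟩
        (D * W + D * W) ^ D             ≡⟨ cong (_^ D) (x*y+x*y≡2*x*y D W) ⟩
        (2 * D * W) ^ D                 ≡⟨ ^-distribʳ-* (2 * D) W D ⟩
        (2 * D) ^ D * (W * W ^ suc d)   ≡⟨ *-assoc ((2 * D) ^ D) W (W ^ suc d) ⟨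
        (2 * D) ^ D * W * W ^ suc d     ∎)
      U-large : n ^ D ≤ K′ * W
      U-large = ≤-trans n^D≤[2D]^D*W (*-monoˡ-≤ W (m≤m+n ((2 * D) ^ D) K))

  volume-bound : ∀ d K (U : Node n (2 + d) → Bool) → n ^ (2 + d) ≤ K * volume (2 + d) (not ∘ U) →
    volume (2 + d) U ^ suc d ≤ ((2 + isoConstant ((2 * (2 + d)) ^ (2 + d) + K) (suc d)) * lineTotal (2 + d) mixed U) ^ (2 + d)
  volume-bound d K U Uᶜ-large with 0 <? volume (2 + d) U
  ... | no W≯0 rewrite n≤0⇒n≡0 (≮⇒≥ W≯0) = z≤n
  ... | yes 0<W = by-cases ((2 + d) * volume (2 + d) U ≤? n * M)
    where
    M = lineTotal (2 + d) mixed U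
    G = isoConstant ((2 * (2 + d)) ^ (2 + d) + K) (suc d)
    by-cases : Dec ((2 + d) * volume (2 + d) U ≤ n * M) → volume (2 + d) U ^ suc d ≤ ((2 + G) * M) ^ (2 + d)
    by-cases (yes DW≤nM) =
      ≤-trans (many-mixed⇒volume-bound d U 0<W DW≤nM) (^-monoˡ-≤ (2 + d) (*-monoˡ-≤ M (m≤m+n 2 G)))
    by-cases (no DW≰nM) =
      ≤-trans (few-mixed⇒volume-bound d U 0<W K Uᶜ-large (≰⇒> DW≰nM)) (^-monoˡ-≤ (2 + d) (*-monoˡ-≤ M (m≤n+m G 2)))

-- Charging mixed lines to communication

_≟ᴺ_ : ∀ {n d} → DecidableEquality (Node n d)
_≟ᴺ_ = ≡-dec _≟_

module _ {n : ℕ} where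

  ChargesBoundary : ∀ {d} → (Node n d → Bool) → (Node n d → ℕ) → Set
  ChargesBoundary U c = ∀ u v → Arc u v → U u ≢ U v → 1 ≤ c u

  Arc-∷ : ∀ {d} t {u v : Node n d} → Arc u v → Arc (t ∷ u) (t ∷ v)
  Arc-∷ t (k , next , rest) = suc k , next , λ where
    zero _ → refl
    (suc j) j≢k → rest j (j≢k ∘ cong suc)

  Arc-head : ∀ {d t t′} (y : Node n d) → toℕ t′ ≡ suc (toℕ t) → Arc (t ∷ y) (t′ ∷ y)
  Arc-head y next = zero , next , λ where
    zero 0≢0 → ⊥-elim (0≢0 refl)
    (suc j) _ → refl

  mixed-lines≤charge : ∀ d k U c → ChargesBoundary U c → lineCount d k mixed U ≤ cubeSum d c
  mixed-lines≤charge (suc d) zero U c charged = begin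
    cubeSum d (λ y → 𝟙 (mixed (λ t → U (t ∷ y))))   ≤⟨ cubeSum-mono-≤ d mixed≤ ⟩
    cubeSum d (λ y → ∑[ t < n ] c (t ∷ y))          ≡⟨ ∑-cubeSum-comm d (λ t y → c (t ∷ y)) ⟨
    cubeSum (suc d) c                               ∎
    where
    open ≤-Reasoning
    mixed≤ : ∀ y → 𝟙 (mixed (λ t → U (t ∷ y))) ≤ ∑[ t < n ] c (t ∷ y)
    mixed≤ y with mixed (λ t → U (t ∷ y)) in mixed-line
    ... | false = z≤n
    ... | true with t , t′ , adjacent , U≢ ← mixed⇒switch _ mixed-line =
      ≤-trans (charged _ _ (Arc-head y adjacent) U≢) (term≤sum (λ t → c (t ∷ y)) t)
  mixed-lines≤charge (suc d) (suc k) U c charged = sum-mono-≤ λ t →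
    mixed-lines≤charge d k (U ∘ (t ∷_)) (c ∘ (t ∷_)) λ u v arc → charged _ _ (Arc-∷ t arc)

  volume-singleton : ∀ d (v : Node n d) → volume d (λ u → does (v ≟ᴺ u)) ≡ 1
  volume-singleton zero [] = refl
  volume-singleton (suc d) (i ∷ v) = trans (sum-cong-≗ slice) (card-singleton i)
    where
    slice : ∀ t → cubeSum d (λ y → 𝟙 (does (i ≟ t) ∧ does (v ≟ᴺ y))) ≡ 𝟙 (does (i ≟ t))
    slice t with does (i ≟ t)
    ... | true = volume-singleton d v
    ... | false = cubeSum-zero d

  count-fibres : ∀ d {A : Set} (P : A → Bool) (f : A → Node n d) xs →
    cubeSum d (λ u → count (λ x → P x ∧ does (f x ≟ᴺ u)) xs) ≡ count P xs
  count-fibres d P f [] = cubeSum-zero d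
  count-fibres d P f (x ∷ xs) = trans (cubeSum-distrib-+ d _ _) (cong₂ _+_ fibre (count-fibres d P f xs))
    where
    fibre : cubeSum d (λ u → 𝟙 (P x ∧ does (f x ≟ᴺ u))) ≡ 𝟙 (P x)
    fibre with P x
    ... | true = volume-singleton d (f x)
    ... | false = cubeSum-zero d

  count-allNodes : ∀ d P → count P (allNodes n d) ≡ volume d P
  count-allNodes zero P = +-identityʳ _
  count-allNodes (suc d) P = trans (count-concatMap-tabulate P (λ i → map (i ∷_) (allNodes n d)) id)
    (sum-cong-≗ λ i → trans (count-map P (i ∷_) (allNodes n d)) (count-allNodes d (P ∘ (i ∷_))))

  cubeSum-sumᴸ-≤ : ∀ d {A : Set} k (c : A → Node n d → ℕ) (h : A → ℕ) → (∀ s → cubeSum d (c s) ≤ k * h s) →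
    ∀ xs → cubeSum d (λ u → sumᴸ (map (λ s → c s u) xs)) ≤ k * sumᴸ (map h xs)
  cubeSum-sumᴸ-≤ d k c h bound [] = ≤-trans (≤-reflexive (cubeSum-zero d)) z≤n
  cubeSum-sumᴸ-≤ d k c h bound (s ∷ xs) = begin
    cubeSum d (λ u → c s u + sumᴸ (map (λ s → c s u) xs))        ≡⟨ cubeSum-distrib-+ d (c s) _ ⟩
    cubeSum d (c s) + cubeSum d (λ u → sumᴸ (map (λ s → c s u) xs)) ≤⟨ +-mono-≤ (bound s) (cubeSum-sumᴸ-≤ d k c h bound xs) ⟩
    k * h s + k * sumᴸ (map h xs)                                  ≡⟨ *-distribˡ-+ k (h s) _ ⟨
    k * (h s + sumᴸ (map h xs))                                    ∎
    where open ≤-Reasoning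

payload : ∀ {n d p} → Msg n d p → Node n d
payload (_ , _ , u) = u

module _ {n d p} (A : BSPAlg n d p) (valid : Valid A) where
  open BSPAlg A
  open Valid valid

  evaluatedBy : Fin p → Node n d → Bool
  evaluatedBy q u = does (proc u ≟ q)

  involves : Fin p → Msg n d p → Bool
  involves q m = does (sender m ≟ q) ∨ does (receiver m ≟ q)

  involves-sender : ∀ {q} m → sender m ≡ q → involves q m ≡ true
  involves-sender {q} m sent = cong (_∨ does (receiver m ≟ q)) (dec-true (sender m ≟ q) sent)

  involves-receiver : ∀ {q} m → receiver m ≡ q → involves q m ≡ true
  involves-receiver {q} m received =
    trans (cong (does (sender m ≟ q) ∨_) (dec-true (receiver m ≟ q) received)) (∨-zeroʳ _)

  charge : Fin p → Node n d → ℕ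
  charge q u = sumᴸ (map (λ s → count (λ m → involves q m ∧ does (payload m ≟ᴺ u)) (msgs s)) (upTo S))

  sent-before-end : ∀ {t m} → m ∈ msgs t → t < S
  sent-before-end {t} m∈ with t <? S
  ... | yes t<S = t<S
  ... | no t≮S = contradiction (subst (_ ∈_) (noLate t (≮⇒≥ t≮S)) m∈) λ ()

  SentByEvaluator : ℕ → Set
  SentByEvaluator t = ∀ {a b u} → (a , b , u) ∈ msgs t → ∃₂ λ t′ b′ → (proc u , b′ , u) ∈ msgs t′

  sent-by-evaluator : ∀ t → SentByEvaluator t
  sent-by-evaluator = <-rec SentByEvaluator trace
    where
    trace : ∀ t → (∀ {s} → s < t → SentByEvaluator s) → SentByEvaluator t
    trace t earlier {a} {b} {u} m∈ with sendOK t a b u m∈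
    ... | inj₁ (proc≡a , _) = t , b , subst (λ x → (x , b , u) ∈ msgs t) (sym proc≡a) m∈
    ... | inj₂ (s , s<t , a′ , m′∈) = earlier s<t m′∈

  involved⇒charged : ∀ q {t} m → m ∈ msgs t → involves q m ≡ true → 1 ≤ charge q (payload m)
  involved⇒charged q {t} m m∈ involved =
    ≤-trans (∈⇒1≤count _ m∈ about) (∈⇒≤sumᴸ (λ s → count _ (msgs s)) (∈-upTo⁺ (sent-before-end m∈)))
    where
    about : involves q m ∧ does (payload m ≟ᴺ payload m) ≡ true
    about = cong₂ _∧_ involved (dec-true (payload m ≟ᴺ payload m) refl)

  charge-boundary : ∀ q → ChargesBoundary (evaluatedBy q) (charge q)
  charge-boundary q u v arc U≢ with proc u ≟ q | proc v ≟ q | evalOK u v arc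
  ... | yes _ | yes _ | _ = ⊥-elim (U≢ refl)
  ... | no _ | no _ | _ = ⊥-elim (U≢ refl)
  ... | yes u↦q | no v↛q | inj₁ (same , _) = ⊥-elim (v↛q (trans (sym same) u↦q))
  ... | no u↛q | yes v↦q | inj₁ (same , _) = ⊥-elim (u↛q (trans same v↦q))
  ... | yes u↦q | no _ | inj₂ (t , _ , _ , m∈) with t′ , b′ , m′∈ ← sent-by-evaluator t m∈ =
    involved⇒charged q (proc u , b′ , u) m′∈ (involves-sender (proc u , b′ , u) u↦q)
  ... | no _ | yes v↦q | inj₂ (t , _ , a , m∈) =
    involved⇒charged q (a , proc v , u) m∈ (involves-receiver (a , proc v , u) v↦q)

  involved≤2h : ∀ q s → count (involves q) (msgs s) ≤ 2 * h s
  involved≤2h q s = begin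
    count (involves q) (msgs s)                     ≤⟨ count-∨ _ _ (msgs s) ⟩
    count (does ∘ sent-by-q) (msgs s)
      + count (does ∘ received-by-q) (msgs s)       ≡⟨ cong₂ _+_ (length-filter≡count sent-by-q (msgs s))
                                                               (length-filter≡count received-by-q (msgs s)) ⟨
    sent q s + recv q s                             ≤⟨ +-mono-≤ (≤-trans (m≤m⊔n (sent q s) (recv q s)) traffic≤h)
                                                                (≤-trans (m≤n⊔m (sent q s) (recv q s)) traffic≤h) ⟩
    h s + h s                                       ≡⟨ cong (h s +_) (+-identityʳ (h s)) ⟨
    2 * h s                                         ∎
    where
    open ≤-Reasoning
    sent-by-q : ∀ m → Dec (sender m ≡ q)
    sent-by-q m = sender m ≟ q
    received-by-q : ∀ m → Dec (receiver m ≡ q)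
    received-by-q m = receiver m ≟ q
    traffic≤h : sent q s ⊔ recv q s ≤ h s
    traffic≤h = maxOver-≥ p (λ q′ → sent q′ s ⊔ recv q′ s) q

  charge-total : ∀ q → cubeSum d (charge q) ≤ 2 * H
  charge-total q = cubeSum-sumᴸ-≤ d 2 (λ s u → count (λ m → involves q m ∧ does (payload m ≟ᴺ u)) (msgs s)) h
    (λ s → ≤-trans (≤-reflexive (count-fibres d (involves q) payload (msgs s))) (involved≤2h q s)) (upTo S)

  mixed-lines≤2H : ∀ q k → lineCount d k mixed (evaluatedBy q) ≤ 2 * H
  mixed-lines≤2H q k = ≤-trans (mixed-lines≤charge d k _ (charge q) (charge-boundary q)) (charge-total q)

  load≡volume : ∀ q → load q ≡ volume d (evaluatedBy q)
  load≡volume q = trans (length-filter≡count (λ u → proc u ≟ q) (allNodes n d)) (count-allNodes d (evaluatedBy q))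

lemma3 : (d : ℕ) → 2 ≤ d → (a b : ℕ) → 0 < a → a < b →
    Σ ℕ λ c → 0 < c ×
      ((n p : ℕ) → 1 < p → p ≤ n ^ (d ∸ 1) →
       (A : BSPAlg n d p) → Valid A →
       b * BSPAlg.W A ≤ a * n ^ d →
       BSPAlg.W A ^ (d ∸ 1) ≤ c * BSPAlg.H A ^ d)
lemma3 (suc zero) (s≤s ())
lemma3 (suc (suc d)) _ a b _ a<b = c , m^n>0 ((2 + G) * D * 2) D , bound
  where
  D = 2 + d
  G = isoConstant ((2 * D) ^ D + b) (suc d)
  c = ((2 + G) * D * 2) ^ D
  bound : (n p : ℕ) → 1 < p → p ≤ n ^ suc d → (A : BSPAlg n D p) → Valid A →
    b * BSPAlg.W A ≤ a * n ^ D → BSPAlg.W A ^ suc d ≤ c * BSPAlg.H A ^ D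
  bound n p _ _ A valid bW≤an^D with maxOver-attained p (BSPAlg.load A)
  ... | inj₁ W≡0 = ≤-trans (≤-reflexive (cong (_^ suc d) W≡0)) z≤n
  ... | inj₂ (q , W≡load) = begin
    W ^ suc d                              ≡⟨ cong (_^ suc d) W≡volume ⟩
    volume D U ^ suc d                     ≤⟨ volume-bound d b U (complement-large D U a<b (subst (λ w → b * w ≤ a * n ^ D) W≡volume bW≤an^D)) ⟩
    ((2 + G) * lineTotal D mixed U) ^ D    ≤⟨ ^-monoˡ-≤ D (*-monoʳ-≤ (2 + G) (sum-≤-const (mixed-lines≤2H A valid q))) ⟩
    ((2 + G) * (D * (2 * H))) ^ D          ≡⟨ cong (_^ D) (regroup (2 + G) D H) ⟩
    ((2 + G) * D * 2 * H) ^ D              ≡⟨ ^-distribʳ-* ((2 + G) * D * 2) H D ⟩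
    c * H ^ D                              ∎
    where
    open ≤-Reasoning
    open BSPAlg A using (W; H)
    U = evaluatedBy A valid q
    W≡volume : W ≡ volume D U
    W≡volume = trans W≡load (load≡volume A valid q)
    regroup : ∀ x y z → x * (y * (2 * z)) ≡ x * y * 2 * z
    regroup = solve-∀
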